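{- Let $t$ be a term with $\mathrm{normal}(t)$. Then there is a tight derivation in the CbN type system of $\vdash^{(0,0)} t:\mathsf{normal}$.
   Context: Terms: $t,s ::= x \mid \lambda x.t \mid t\,s \mid t[x\leftarrow s]$, where $t[x\leftarrow s]$ (explicit substitution) binds $x$ in $t$. $\mathrm{normal}$: least predicate with $\mathrm{normal}(\lambda x.t)$ and $\mathrm{normal}(t)\Rightarrow\mathrm{normal}(t[x\leftarrow s])$. CbN types: linear types $L ::= \mathsf{normal}\mid M\to L$; multi types $M ::= [L_i]_{i\in J}$ finite multisets, $\mathbf 0$ the empty multiset, $\uplus$ union. Type contexts $\Gamma$ map variables to multi types, all but finitely many to $\mathbf 0$; $\mathrm{dom}(\Gamma)=\{x\mid\Gamma(x)\neq\mathbf 0\}$; $\Gamma$ is empty if its domain is empty; $\uplus$ pointwise; $\Gamma,x:M$ means $\Gamma\uplus(x\mapsto M)$ with $x\notin\mathrm{dom}(\Gamma)$; $\Gamma\setminus\!\!\setminus x$ is $\Gamma$ with $x$ mapped to $\mathbf 0$. Rules: (ax) $x:[L]\vdash^{(0,1)} x:L$; (normal) $\vdash^{(0,0)}\lambda x.t:\mathsf{normal}$; (fun) from $\Gamma\vdash^{(m,e)} t:L$ infer $\Gamma\setminus\!\!\setminus x\vdash^{(m,e)}\lambda x.t:\Gamma(x)\to L$; (many) from $\Pi_i\vdash^{(m_i,e_i)} t:L_i$ for $i\in J$ ($J$ finite, possibly empty) infer $\biguplus_i\Pi_i\vdash^{(\sum m_i,\sum e_i)} t:[L_i]_{i\in J}$;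 (app) from $\Gamma\vdash^{(m,e)} t:M\to L$ and $\Pi\vdash^{(m',e')} s:M$ infer $\Gamma\uplus\Pi\vdash^{(m+m'+1,e+e')} t\,s:L$; (ES) from $\Gamma,x:M\vdash^{(m,e)} t:L$ and $\Pi\vdash^{(m',e')} s:M$ infer $\Gamma\uplus\Pi\vdash^{(m+m',e+e')} t[x\leftarrow s]:L$. A derivation of $\Gamma\vdash^{(m,e)} t:L$ is tight if $L=\mathsf{normal}$ and $\Gamma$ is empty. -}

module Defs where

open import Data.Nat using (ℕ; _+_; _≟_)
open import Data.List using (List; []; _∷_; _++_; map; foldr)
open import Data.Product using (_×_; _,_)
open import Relation.Nullary using (yes; no)
open import Data.List.Relation.Binary.Permutation.Homogeneous using (Permutation)

Var : Set
Var = ℕ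

data Term : Set where
  var : Var → Term
  lam : Var → Term → Term
  app : Term → Term → Term
  es  : Term → Var → Term → Term     -- es t x s  =  t[x ← s]

data Normal : Term → Set where
  normal-lam : ∀ x t → Normal (lam x t)
  normal-es  : ∀ t x s → Normal t → Normal (es t x s)

-- CbN types. Multi types (finite multisets) are represented by lists,
-- taken up to the equivalence _≈M_ below (permutation, recursively).
mutual
  data LType : Set where
    normal : LType
    _⇒_    : MType → LType → LType

  MType : Set
  MType = List LType

data _≈L_ : LType → LType → Set where
  normal≈ : normal ≈L normal
  ⇒≈      : ∀ {M M' L L'} → Permutation _≈L_ M M' → L ≈L L' → (M ⇒ L) ≈L (M' ⇒ L')

_≈M_ : MType → MType → Set
M ≈M M' = Permutation _≈L_ M M'

Ctx : Set
Ctx = Var → MType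

𝟘 : MType
𝟘 = []

emptyCtx : Ctx
emptyCtx _ = 𝟘

IsEmptyCtx : Ctx → Set
IsEmptyCtx Γ = ∀ x → Γ x ≈M 𝟘

_⊎Γ_ : Ctx → Ctx → Ctx
(Γ ⊎Γ Π) y = Γ y ++ Π y

single : Var → LType → Ctx
single x L y with y ≟ x
... | yes _ = L ∷ []
... | no  _ = []

_∖∖_ : Ctx → Var → Ctx
(Γ ∖∖ x) y with y ≟ x
... | yes _ = []
... | no  _ = Γ y

mutual
  data _⊢[_,_]_∶_ : Ctx → ℕ → ℕ → Term → LType → Set where
    ax     : ∀ x L → single x L ⊢[ 0 , 1 ] var x ∶ L
    ty-normal : ∀ x t → emptyCtx ⊢[ 0 , 0 ] lam x t ∶ normal
    fun    : ∀ {Γ m e x t L} → Γ ⊢[ m , e ] t ∶ L →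
             (Γ ∖∖ x) ⊢[ m , e ] lam x t ∶ (Γ x ⇒ L)
    ty-app : ∀ {Γ Π m e m' e' t s M M' L} →
             Γ ⊢[ m , e ] t ∶ (M ⇒ L) → Π ⊩[ m' , e' ] s ∶ M' → M ≈M M' →
             (Γ ⊎Γ Π) ⊢[ m + m' + 1 , e + e' ] app t s ∶ L
    ty-es  : ∀ {Γ Π m e m' e' t x s M' L} →
             Γ ⊢[ m , e ] t ∶ L → Π ⊩[ m' , e' ] s ∶ M' → Γ x ≈M M' →
             ((Γ ∖∖ x) ⊎Γ Π) ⊢[ m + m' , e + e' ] es t x s ∶ L

  data _⊩[_,_]_∶_ : Ctx → ℕ → ℕ → Term → MType → Set where
    many-[] : ∀ {t} → emptyCtx ⊩[ 0 , 0 ] t ∶ []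
    many-∷  : ∀ {Γ Π m e m' e' t L M} →
              Γ ⊢[ m , e ] t ∶ L → Π ⊩[ m' , e' ] t ∶ M →
              (Γ ⊎Γ Π) ⊩[ m + m' , e + e' ] t ∶ (L ∷ M)

record TightDerivation (m e : ℕ) (t : Term) : Set where
  constructor tight
  field
    Γ     : Ctx
    Γ-empty : IsEmptyCtx Γ
    deriv : Γ ⊢[ m , e ] t ∶ normal

module Submission where

-- The proof is by induction on the derivation of normal(t).
--   * An abstraction λx.t is typed by rule (normal) in the empty context.
--   * For t[x←s] with t normal, the induction hypothesis gives a tight
--     derivation of t.  Its context is empty, so x is assigned the empty
--     multi type 0, and the argument s only has to be typed with 0: rule
--     (many) with no premises, in the empty context with counters (0,0).

open import Defs
open import Data.Nat using (_≟_)
open import Data.List using ([])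
open import Data.Nat.Properties using (+-identityʳ)
open import Relation.Nullary using (yes; no)
open import Relation.Binary.PropositionalEquality using (_≡_; subst₂)
open import Data.List.Relation.Binary.Permutation.Homogeneous using (refl; trans)
open import Data.List.Relation.Binary.Pointwise using ([])

emptyCtx-isEmpty : IsEmptyCtx emptyCtx
emptyCtx-isEmpty _ = refl []

-- The only multi type equivalent to 0 is 0 itself (permutations preserve
-- length); so a context entry equivalent to 0 contributes nothing to a union.
≈𝟘⇒≡𝟘 : ∀ {M} → M ≈M 𝟘 → M ≡ 𝟘
≈𝟘⇒≡𝟘 (refl [])     = _≡_.refl
≈𝟘⇒≡𝟘 (trans p q) with ≈𝟘⇒≡𝟘 q
... | _≡_.refl = ≈𝟘⇒≡𝟘 p

∖∖-isEmpty : ∀ {Γ} x → IsEmptyCtx Γ → IsEmptyCtx (Γ ∖∖ x)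
∖∖-isEmpty {Γ} x Γ-empty y with y ≟ x
... | yes _ = refl []
... | no  _ = Γ-empty y

⊎Γ-isEmpty : ∀ {Γ Π} → IsEmptyCtx Γ → IsEmptyCtx Π → IsEmptyCtx (Γ ⊎Γ Π)
⊎Γ-isEmpty {Γ} {Π} Γ-empty Π-empty y
  rewrite ≈𝟘⇒≡𝟘 (Γ-empty y) = Π-empty y

-- Rule (ES) for a variable that the body does not use (its type is 0):
-- the substituted term needs no typing, so t[x←s] keeps the tight
-- derivation of t, with the same counters.
es-unused : ∀ {m e t} x s → TightDerivation m e t → TightDerivation m e (es t x s)
es-unused {m} {e} {t} x s (tight Γ Γ-empty d) =
  tight ((Γ ∖∖ x) ⊎Γ emptyCtx)
        (⊎Γ-isEmpty (∖∖-isEmpty x Γ-empty) emptyCtx-isEmpty)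
        derivation
  where
  -- (ES) adds the counters of the empty (many) premise, i.e. (m+0, e+0).
  derivation : ((Γ ∖∖ x) ⊎Γ emptyCtx) ⊢[ m , e ] es t x s ∶ normal
  derivation = subst₂ (λ m′ e′ → ((Γ ∖∖ x) ⊎Γ emptyCtx) ⊢[ m′ , e′ ] es t x s ∶ normal)
                      (+-identityʳ m) (+-identityʳ e)
                      (ty-es d many-[] (Γ-empty x))

proposition4 : (t : Term) → Normal t → TightDerivation 0 0 t
proposition4 .(lam x t) (normal-lam x t)   = tight emptyCtx emptyCtx-isEmpty (ty-normal x t)
proposition4 .(es t x s) (normal-es t x s n) = es-unused x s (proposition4 t n)
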